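{- Let $U:\mathcal{E}\to\mathcal{B}$ be an opfibration, let $K:\mathcal{B}\to\mathcal{E}$ be a full and faithful functor with $UK=Id_{\mathcal{B}}$, and let $C:\mathcal{E}\to\mathcal{B}$ be a right adjoint to $K$ with counit $\epsilon$. Let $F:\mathcal{B}\to\mathcal{B}$ be a functor, and define $\pi:\mathcal{E}\to\mathcal{B}^{\to}$ by $\pi P=U\epsilon_P$, $I:\mathcal{B}^{\to}\to\mathcal{E}$ by $I(f:X\to Y)=\Sigma_fKX$, and $\hat F=I\,F^{\to}\,\pi:\mathcal{E}\to\mathcal{E}$. Then $U\hat F=FU$ and $\hat FK\cong KF$.
   Context: $U$ is an opfibration: for every object $P$ of $\mathcal{E}$ and $f:UP\to Y$ in $\mathcal{B}$ there is an opcartesian morphism above $f$ with domain $P$ (i.e. $g:P\to Q$ with $Ug=f$ such that any $g':P\to Q'$ with $Ug'=vf$ factors uniquely as $hg$ with $Uh=v$); its codomain is $\Sigma_fP$, giving opreindexing functors $\Sigma_f:\mathcal{E}_X\to\mathcal{E}_Y$ between fibres ($I$ extends to morphisms via the universal property). $\mathcal{B}^{\to}$ is the arrow category of $\mathcal{B}$ and $F^{\to}$ applies $F$ to arrows and commuting squares. -}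

module Defs where

-- Categories have hom-setoids; objects are compared with propositional equality
-- (strict equality of functors, as in "U F̂ = F U" and "U K = Id").

open import Level using (Level; _⊔_) renaming (suc to lsuc)
open import Relation.Binary.PropositionalEquality using (_≡_; refl; sym; trans)
open import Relation.Binary.Structures using (IsEquivalence)
open import Relation.Binary.Bundles using (Setoid)
open import Data.Product using (Σ; _,_)
import Relation.Binary.Reasoning.Setoid as SetoidR

record Category (o ℓ e : Level) : Set (lsuc (o ⊔ ℓ ⊔ e)) where
  infixr 9 _∘_
  infix 4 _≈_
  field
    Obj : Set o
    _⇒_ : Obj → Obj → Set ℓ
    _≈_ : ∀ {A B} → A ⇒ B → A ⇒ B → Set e
    id : ∀ {A} → A ⇒ A
    _∘_ : ∀ {A B C} → B ⇒ C → A ⇒ B → A ⇒ C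
    ≈-equiv : ∀ {A B} → IsEquivalence (_≈_ {A} {B})
    assoc : ∀ {A B C D} {f : A ⇒ B} {g : B ⇒ C} {h : C ⇒ D} →
            (h ∘ g) ∘ f ≈ h ∘ (g ∘ f)
    identityˡ : ∀ {A B} {f : A ⇒ B} → id ∘ f ≈ f
    identityʳ : ∀ {A B} {f : A ⇒ B} → f ∘ id ≈ f
    ∘-resp-≈ : ∀ {A B C} {f h : B ⇒ C} {g i : A ⇒ B} →
               f ≈ h → g ≈ i → f ∘ g ≈ h ∘ i

  module Equiv {A B : Obj} = IsEquivalence (≈-equiv {A} {B})

  hom-setoid : Obj → Obj → Setoid ℓ e
  hom-setoid A B = record { Carrier = A ⇒ B ; _≈_ = _≈_ ; isEquivalence = ≈-equiv }

  cast : ∀ {A A' B B'} → A ≡ A' → B ≡ B' → A ⇒ B → A' ⇒ B'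
  cast refl refl f = f

  cast-∘ : ∀ {A A' B B' C C'} (p : A ≡ A') (q : B ≡ B') (r : C ≡ C')
           (f : B ⇒ C) (g : A ⇒ B) → cast q r f ∘ cast p q g ≡ cast p r (f ∘ g)
  cast-∘ refl refl refl f g = refl

  cast-resp : ∀ {A A' B B'} (p : A ≡ A') (q : B ≡ B') {f g : A ⇒ B} →
              f ≈ g → cast p q f ≈ cast p q g
  cast-resp refl refl x = x

  cast-trans : ∀ {A A' A'' B B' B''} (p : A ≡ A') (p' : A' ≡ A'')
               (q : B ≡ B') (q' : B' ≡ B'') (f : A ⇒ B) →
               cast p' q' (cast p q f) ≡ cast (trans p p') (trans q q') f
  cast-trans refl refl refl refl f = refl

  cast-sym : ∀ {A A' B B'} (p : A ≡ A') (q : B ≡ B') (f : A ⇒ B) →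
             cast (sym p) (sym q) (cast p q f) ≡ f
  cast-sym refl refl f = refl

  cast-sym' : ∀ {A A' B B'} (p : A ≡ A') (q : B ≡ B') (f : A' ⇒ B') →
              cast p q (cast (sym p) (sym q) f) ≡ f
  cast-sym' refl refl f = refl

open Category using (Obj)

infix 10 _[_,_] _[_≈_] _[_∘_]

_[_,_] : ∀ {o ℓ e} (C : Category o ℓ e) → Obj C → Obj C → Set ℓ
C [ A , B ] = Category._⇒_ C A B

_[_≈_] : ∀ {o ℓ e} (C : Category o ℓ e) {A B : Obj C} → C [ A , B ] → C [ A , B ] → Set e
C [ f ≈ g ] = Category._≈_ C f g

_[_∘_] : ∀ {o ℓ e} (C : Category o ℓ e) {A B D : Obj C} → C [ B , D ] → C [ A , B ] → C [ A , D ]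
C [ f ∘ g ] = Category._∘_ C f g

record PreFunctor {o ℓ e o' ℓ' e'} (C : Category o ℓ e) (D : Category o' ℓ' e')
       : Set (o ⊔ ℓ ⊔ o' ⊔ ℓ') where
  field
    F₀ : Obj C → Obj D
    F₁ : ∀ {A B} → C [ A , B ] → D [ F₀ A , F₀ B ]

record Functor {o ℓ e o' ℓ' e'} (C : Category o ℓ e) (D : Category o' ℓ' e')
       : Set (o ⊔ ℓ ⊔ e ⊔ o' ⊔ ℓ' ⊔ e') where
  field
    F₀ : Obj C → Obj D
    F₁ : ∀ {A B} → C [ A , B ] → D [ F₀ A , F₀ B ]
    identity : ∀ {A} → D [ F₁ (Category.id C {A}) ≈ Category.id D ]
    homomorphism : ∀ {X Y Z} {f : C [ X , Y ]} {g : C [ Y , Z ]} →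
                   D [ F₁ (C [ g ∘ f ]) ≈ D [ F₁ g ∘ F₁ f ] ]
    F-resp-≈ : ∀ {A B} {f g : C [ A , B ]} → C [ f ≈ g ] → D [ F₁ f ≈ F₁ g ]

  pre : PreFunctor C D
  pre = record { F₀ = F₀ ; F₁ = F₁ }

module _ {o ℓ e o' ℓ' e' o'' ℓ'' e''}
         {C : Category o ℓ e} {D : Category o' ℓ' e'} {E : Category o'' ℓ'' e''} where
  infixr 9 _∘P_
  _∘P_ : PreFunctor D E → PreFunctor C D → PreFunctor C E
  G ∘P F = record { F₀ = λ X → PreFunctor.F₀ G (PreFunctor.F₀ F X)
                  ; F₁ = λ f → PreFunctor.F₁ G (PreFunctor.F₁ F f) }

idP : ∀ {o ℓ e} (C : Category o ℓ e) → PreFunctor C C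
idP C = record { F₀ = λ X → X ; F₁ = λ f → f }

record _≡F_ {o ℓ e o' ℓ' e'} {C : Category o ℓ e} {D : Category o' ℓ' e'}
       (F G : PreFunctor C D) : Set (o ⊔ ℓ ⊔ o' ⊔ e') where
  open PreFunctor
  field
    eq₀ : ∀ X → F₀ F X ≡ F₀ G X
    eq₁ : ∀ {X Y} (f : C [ X , Y ]) →
          D [ Category.cast D (eq₀ X) (eq₀ Y) (F₁ F f) ≈ F₁ G f ]

record NatIso {o ℓ e o' ℓ' e'} {C : Category o ℓ e} {D : Category o' ℓ' e'}
       (F G : PreFunctor C D) : Set (o ⊔ ℓ ⊔ o' ⊔ ℓ' ⊔ e') where
  open PreFunctor
  field
    η : ∀ X → D [ F₀ F X , F₀ G X ]
    η⁻¹ : ∀ X → D [ F₀ G X , F₀ F X ]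
    commute : ∀ {X Y} (f : C [ X , Y ]) → D [ D [ η Y ∘ F₁ F f ] ≈ D [ F₁ G f ∘ η X ] ]
    isoˡ : ∀ X → D [ D [ η⁻¹ X ∘ η X ] ≈ Category.id D ]
    isoʳ : ∀ X → D [ D [ η X ∘ η⁻¹ X ] ≈ Category.id D ]

module _ {o ℓ e o' ℓ' e'} {C : Category o ℓ e} {D : Category o' ℓ' e'} (F : Functor C D) where
  open Functor F

  Full : Set (o ⊔ ℓ ⊔ ℓ' ⊔ e')
  Full = ∀ {X Y} (g : D [ F₀ X , F₀ Y ]) → Σ (C [ X , Y ]) (λ f → D [ F₁ f ≈ g ])

  Faithful : Set (o ⊔ ℓ ⊔ e ⊔ e')
  Faithful = ∀ {X Y} (f g : C [ X , Y ]) → D [ F₁ f ≈ F₁ g ] → C [ f ≈ g ]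

record Adjunction {o ℓ e o' ℓ' e'} {B : Category o ℓ e} {E : Category o' ℓ' e'}
       (K : Functor B E) (C : Functor E B) : Set (o ⊔ ℓ ⊔ e ⊔ o' ⊔ ℓ' ⊔ e') where
  private
    module K = Functor K
    module C = Functor C
  field
    unit : ∀ X → B [ X , C.F₀ (K.F₀ X) ]
    counit : ∀ P → E [ K.F₀ (C.F₀ P) , P ]
    unit-natural : ∀ {X Y} (f : B [ X , Y ]) →
                   B [ B [ unit Y ∘ f ] ≈ B [ C.F₁ (K.F₁ f) ∘ unit X ] ]
    counit-natural : ∀ {P Q} (h : E [ P , Q ]) →
                     E [ E [ counit Q ∘ K.F₁ (C.F₁ h) ] ≈ E [ h ∘ counit P ] ]
    zig : ∀ X → E [ E [ counit (K.F₀ X) ∘ K.F₁ (unit X) ] ≈ Category.id E ]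
    zag : ∀ P → B [ B [ C.F₁ (counit P) ∘ unit (C.F₀ P) ] ≈ Category.id B ]

module _ {o ℓ e o' ℓ' e'} {E : Category o ℓ e} {B : Category o' ℓ' e'}
         (U : Functor E B) where
  open Functor U renaming (F₀ to U₀; F₁ to U₁)

  record IsOpcartesian {P Q : Obj E} (g : E [ P , Q ]) : Set (o ⊔ ℓ ⊔ e ⊔ ℓ' ⊔ e') where
    field
      factor : ∀ {Q'} (g' : E [ P , Q' ]) (v : B [ U₀ Q , U₀ Q' ]) →
               B [ U₁ g' ≈ B [ v ∘ U₁ g ] ] → E [ Q , Q' ]
      factor-over : ∀ {Q'} (g' : E [ P , Q' ]) (v : B [ U₀ Q , U₀ Q' ])
                    (p : B [ U₁ g' ≈ B [ v ∘ U₁ g ] ]) → B [ U₁ (factor g' v p) ≈ v ]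
      factor-comm : ∀ {Q'} (g' : E [ P , Q' ]) (v : B [ U₀ Q , U₀ Q' ])
                    (p : B [ U₁ g' ≈ B [ v ∘ U₁ g ] ]) → E [ E [ factor g' v p ∘ g ] ≈ g' ]
      factor-unique : ∀ {Q'} (g' : E [ P , Q' ]) (v : B [ U₀ Q , U₀ Q' ])
                      (p : B [ U₁ g' ≈ B [ v ∘ U₁ g ] ]) (h : E [ Q , Q' ]) →
                      B [ U₁ h ≈ v ] → E [ E [ h ∘ g ] ≈ g' ] → E [ h ≈ factor g' v p ]

  record Opfibration : Set (o ⊔ ℓ ⊔ e ⊔ o' ⊔ ℓ' ⊔ e') where
    field
      Σ₀ : ∀ P {Y} → B [ U₀ P , Y ] → Obj E
      Σ-over : ∀ P {Y} (f : B [ U₀ P , Y ]) → U₀ (Σ₀ P f) ≡ Y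
      lift : ∀ P {Y} (f : B [ U₀ P , Y ]) → E [ P , Σ₀ P f ]
      lift-over : ∀ P {Y} (f : B [ U₀ P , Y ]) →
                  B [ Category.cast B refl (Σ-over P f) (U₁ (lift P f)) ≈ f ]
      lift-opcart : ∀ P {Y} (f : B [ U₀ P , Y ]) → IsOpcartesian (lift P f)

module _ {o ℓ e} (B : Category o ℓ e) where
  open Category B

  record ArrObj : Set (o ⊔ ℓ) where
    constructor arr
    field
      {dom cod} : Obj B
      arrow : dom ⇒ cod

  record ArrHom (f g : ArrObj) : Set (ℓ ⊔ e) where
    constructor sq
    private
      module f = ArrObj f
      module g = ArrObj g
    field
      top : f.dom ⇒ g.dom
      bot : f.cod ⇒ g.cod
      comm : bot ∘ f.arrow ≈ g.arrow ∘ top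

  Arrow : Category (o ⊔ ℓ) (ℓ ⊔ e) e
  Arrow = record
    { Obj = ArrObj
    ; _⇒_ = ArrHom
    ; _≈_ = λ s t → (ArrHom.top s ≈ ArrHom.top t) ×' (ArrHom.bot s ≈ ArrHom.bot t)
    ; id = sq id id (trans' identityˡ (sym' identityʳ))
    ; _∘_ = λ {f} {g} {h} t s → sq (ArrHom.top t ∘ ArrHom.top s) (ArrHom.bot t ∘ ArrHom.bot s)
                 (comp-comm {f} {g} {h} t s)
    ; ≈-equiv = record { refl = refl' , refl' ; sym = λ (a , b) → sym' a , sym' b
                       ; trans = λ (a , b) (c , d) → trans' a c , trans' b d }
    ; assoc = assoc , assoc
    ; identityˡ = identityˡ , identityˡ
    ; identityʳ = identityʳ , identityʳ
    ; ∘-resp-≈ = λ (a , b) (c , d) → ∘-resp-≈ a c , ∘-resp-≈ b d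
    }
    where
    open import Data.Product using () renaming (_×_ to _×'_)
    open Equiv renaming (refl to refl'; sym to sym'; trans to trans')
    comp-comm : ∀ {f g h} (t : ArrHom g h) (s : ArrHom f g) →
                (ArrHom.bot t ∘ ArrHom.bot s) ∘ ArrObj.arrow f ≈
                ArrObj.arrow h ∘ (ArrHom.top t ∘ ArrHom.top s)
    comp-comm {f} {g} {h} (sq a' b' c') (sq a b c) = begin
        (b' ∘ b) ∘ ArrObj.arrow f   ≈⟨ assoc ⟩
        b' ∘ (b ∘ ArrObj.arrow f)   ≈⟨ ∘-resp-≈ refl' c ⟩
        b' ∘ (ArrObj.arrow g ∘ a)   ≈⟨ sym' assoc ⟩
        (b' ∘ ArrObj.arrow g) ∘ a   ≈⟨ ∘-resp-≈ c' refl' ⟩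
        (ArrObj.arrow h ∘ a') ∘ a   ≈⟨ assoc ⟩
        ArrObj.arrow h ∘ (a' ∘ a)   ∎
      where open SetoidR (hom-setoid _ _)

module Hat {o ℓ e o' ℓ' e'} {E : Category o ℓ e} {B : Category o' ℓ' e'}
           (U : Functor E B) (op : Opfibration U)
           (K : Functor B E) (UK : (Functor.pre U ∘P Functor.pre K) ≡F idP B)
           (C : Functor E B) (adj : Adjunction K C)
           (F : Functor B B) where

  private
    module E = Category E
    module B = Category B
    module U = Functor U
    module K = Functor K
    module C = Functor C
    module F = Functor F
    module UK = _≡F_ UK
    open Adjunction adj
    open Opfibration op
    open B.Equiv renaming (refl to ≈refl; sym to ≈sym; trans to ≈trans)
    module BR {X Y : B.Obj} = SetoidR (B.hom-setoid X Y)
    open BR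
    open Relation.Binary.PropositionalEquality using () renaming (sym to ≡sym)

    eUK : ∀ X → U.F₀ (K.F₀ X) ≡ X
    eUK = UK.eq₀

    ≡⇒≈ : ∀ {X Y} {f g : B [ X , Y ]} → f ≡ g → B [ f ≈ g ]
    ≡⇒≈ refl = ≈refl

    cast-inj : ∀ {A A' X X'} (p : A ≡ A') (q : X ≡ X') {f g : B [ A , X ]} →
               B [ B.cast p q f ≈ B.cast p q g ] → B [ f ≈ g ]
    cast-inj p q {f} {g} x = begin
      f                                     ≡⟨ Relation.Binary.PropositionalEquality.sym (B.cast-sym p q f) ⟩
      B.cast (≡sym p) (≡sym q) (B.cast p q f) ≈⟨ B.cast-resp (≡sym p) (≡sym q) x ⟩
      B.cast (≡sym p) (≡sym q) (B.cast p q g) ≡⟨ B.cast-sym p q g ⟩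
      g                                     ∎

    cast-split : ∀ {A A' X X'} (p : A ≡ A') (q : X ≡ X') (f : B [ A , X ]) →
                 B.cast p q f ≡ B.cast p refl (B.cast refl q f)
    cast-split refl refl f = refl

    lift-over' : ∀ {X Y} (f : B [ X , Y ]) →
      B [ B.cast (eUK X) (Σ-over (K.F₀ X) (B.cast (≡sym (eUK X)) refl f))
            (U.F₁ (lift (K.F₀ X) (B.cast (≡sym (eUK X)) refl f))) ≈ f ]
    lift-over' {X} f =
      let f' = B.cast (≡sym (eUK X)) refl f in begin
      B.cast (eUK X) (Σ-over _ f') (U.F₁ (lift _ f'))
        ≡⟨ cast-split (eUK X) (Σ-over _ f') _ ⟩
      B.cast (eUK X) refl (B.cast refl (Σ-over _ f') (U.F₁ (lift _ f')))
        ≈⟨ B.cast-resp (eUK X) refl (lift-over _ f') ⟩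
      B.cast (eUK X) refl f'
        ≡⟨ B.cast-sym' (eUK X) refl f ⟩
      f ∎

  -- π P = U ε_P : C P → U P   (using U K = Id)
  π : PreFunctor E (Arrow B)
  π = record
    { F₀ = λ P → arr (B.cast (eUK (C.F₀ P)) refl (U.F₁ (counit P)))
    ; F₁ = λ {P} {Q} h → sq (C.F₁ h) (U.F₁ h) (comm h)
    }
    where
    comm : ∀ {P Q} (h : E [ P , Q ]) →
           B [ B [ U.F₁ h ∘ B.cast (eUK (C.F₀ P)) refl (U.F₁ (counit P)) ]
             ≈ B [ B.cast (eUK (C.F₀ Q)) refl (U.F₁ (counit Q)) ∘ C.F₁ h ] ]
    comm {P} {Q} h = begin
      B [ U.F₁ h ∘ B.cast (eUK (C.F₀ P)) refl (U.F₁ (counit P)) ]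
        ≡⟨ B.cast-∘ (eUK (C.F₀ P)) refl refl (U.F₁ h) (U.F₁ (counit P)) ⟩
      B.cast (eUK (C.F₀ P)) refl (B [ U.F₁ h ∘ U.F₁ (counit P) ])
        ≈⟨ B.cast-resp _ refl (≈sym U.homomorphism) ⟩
      B.cast (eUK (C.F₀ P)) refl (U.F₁ (E [ h ∘ counit P ]))
        ≈⟨ B.cast-resp _ refl (U.F-resp-≈ (Category.Equiv.sym E (counit-natural h))) ⟩
      B.cast (eUK (C.F₀ P)) refl (U.F₁ (E [ counit Q ∘ K.F₁ (C.F₁ h) ]))
        ≈⟨ B.cast-resp _ refl U.homomorphism ⟩
      B.cast (eUK (C.F₀ P)) refl (B [ U.F₁ (counit Q) ∘ U.F₁ (K.F₁ (C.F₁ h)) ])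
        ≡⟨ Relation.Binary.PropositionalEquality.sym
             (B.cast-∘ (eUK (C.F₀ P)) (eUK (C.F₀ Q)) refl _ _) ⟩
      B [ B.cast (eUK (C.F₀ Q)) refl (U.F₁ (counit Q))
          ∘ B.cast (eUK (C.F₀ P)) (eUK (C.F₀ Q)) (U.F₁ (K.F₁ (C.F₁ h))) ]
        ≈⟨ B.∘-resp-≈ ≈refl (UK.eq₁ (C.F₁ h)) ⟩
      B [ B.cast (eUK (C.F₀ Q)) refl (U.F₁ (counit Q)) ∘ C.F₁ h ] ∎

  F→ : PreFunctor (Arrow B) (Arrow B)
  F→ = record
    { F₀ = λ f → arr (F.F₁ (ArrObj.arrow f))
    ; F₁ = λ { {arr f} {arr g} (sq a b c) → sq (F.F₁ a) (F.F₁ b) (begin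
        B [ F.F₁ b ∘ F.F₁ f ] ≈⟨ ≈sym F.homomorphism ⟩
        F.F₁ (B [ b ∘ f ])    ≈⟨ F.F-resp-≈ c ⟩
        F.F₁ (B [ g ∘ a ])    ≈⟨ F.homomorphism ⟩
        B [ F.F₁ g ∘ F.F₁ a ] ∎) }
    }

  I₀ : ArrObj B → Obj E
  I₀ (arr {X} f) = Σ₀ (K.F₀ X) (B.cast (≡sym (eUK X)) refl f)

  I₁ : ∀ {f g} → ArrHom B f g → E [ I₀ f , I₀ g ]
  I₁ {arr {X} {Y} f} {arr {X'} {Y'} g} (sq a b c) =
    IsOpcartesian.factor (lift-opcart (K.F₀ X) f')
      (E [ lift (K.F₀ X') g' ∘ K.F₁ a ]) v prf
    where
    f' = B.cast (≡sym (eUK X)) refl f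
    g' = B.cast (≡sym (eUK X')) refl g
    of = Σ-over (K.F₀ X) f'
    og = Σ-over (K.F₀ X') g'
    v = B.cast (≡sym of) (≡sym og) b
    prf : B [ U.F₁ (E [ lift (K.F₀ X') g' ∘ K.F₁ a ]) ≈ B [ v ∘ U.F₁ (lift (K.F₀ X) f') ] ]
    prf = cast-inj (eUK X) og (begin
      B.cast (eUK X) og (U.F₁ (E [ lift (K.F₀ X') g' ∘ K.F₁ a ]))
        ≈⟨ B.cast-resp (eUK X) og U.homomorphism ⟩
      B.cast (eUK X) og (B [ U.F₁ (lift (K.F₀ X') g') ∘ U.F₁ (K.F₁ a) ])
        ≡⟨ Relation.Binary.PropositionalEquality.sym (B.cast-∘ (eUK X) (eUK X') og _ _) ⟩
      B [ B.cast (eUK X') og (U.F₁ (lift (K.F₀ X') g'))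
          ∘ B.cast (eUK X) (eUK X') (U.F₁ (K.F₁ a)) ]
        ≈⟨ B.∘-resp-≈ (lift-over' g) (UK.eq₁ a) ⟩
      B [ g ∘ a ]
        ≈⟨ ≈sym c ⟩
      B [ b ∘ f ]
        ≈⟨ B.∘-resp-≈ (≡⇒≈ (Relation.Binary.PropositionalEquality.sym (B.cast-sym' of og b)))
                      (≈sym (lift-over' f)) ⟩
      B [ B.cast of og v ∘ B.cast (eUK X) of (U.F₁ (lift (K.F₀ X) f')) ]
        ≡⟨ B.cast-∘ (eUK X) of og _ _ ⟩
      B.cast (eUK X) og (B [ v ∘ U.F₁ (lift (K.F₀ X) f') ]) ∎)

  I : PreFunctor (Arrow B) E
  I = record { F₀ = I₀ ; F₁ = I₁ }

  F̂ : PreFunctor E E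
  F̂ = I ∘P F→ ∘P π

-- U F̂ = F U holds on the nose because opcartesian lifts and their factorisations
-- lie over the prescribed arrows.  For F̂ K ≅ K F: since K is fully faithful the
-- unit X → C K X is invertible, so π (K X) = U ε_{K X} is an isomorphism and so is
-- F applied to it.  An opcartesian arrow over an isomorphism is an isomorphism,
-- hence so is the lift K F C K X → F̂ K X; composing its inverse with K F (unit⁻¹)
-- gives F̂ K X ≅ K F C K X ≅ K F X, naturally in X.
module Submission where

open import Level using (_⊔_)
open import Defs
open import Data.Product using (_×_; _,_; proj₁; proj₂)
open import Relation.Binary.PropositionalEquality using (_≡_; refl; sym)
import Relation.Binary.Reasoning.Setoid as SetoidR

module _ {o ℓ e} (𝒞 : Category o ℓ e) where
  open Category 𝒞

  record IsIso {A B : Obj} (f : A ⇒ B) : Set (ℓ ⊔ e) where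
    field
      inv : B ⇒ A
      isoˡ : inv ∘ f ≈ id
      isoʳ : f ∘ inv ≈ id

  IsIso-resp-≈ : ∀ {A B} {f g : A ⇒ B} → f ≈ g → IsIso f → IsIso g
  IsIso-resp-≈ f≈g i = record
    { inv = inv
    ; isoˡ = Equiv.trans (∘-resp-≈ Equiv.refl (Equiv.sym f≈g)) isoˡ
    ; isoʳ = Equiv.trans (∘-resp-≈ (Equiv.sym f≈g) Equiv.refl) isoʳ
    }
    where open IsIso i

  IsIso-cast : ∀ {A A' B B'} (p : A ≡ A') (q : B ≡ B') {f : A ⇒ B} →
               IsIso f → IsIso (cast p q f)
  IsIso-cast refl refl i = i

  cast-transpose : ∀ {A A' B B'} (p : A ≡ A') (q : B ≡ B') {f : A ⇒ B} {g : A' ⇒ B'} →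
                   cast p q f ≈ g → f ≈ cast (sym p) (sym q) g
  cast-transpose refl refl f≈g = f≈g

module _ {o ℓ e o' ℓ' e'} {𝒞 : Category o ℓ e} {𝒟 : Category o' ℓ' e'}
         (G : Functor 𝒞 𝒟) where
  private
    module 𝒞 = Category 𝒞
    module 𝒟 = Category 𝒟
  open Functor G

  F₁-resp-inverse : ∀ {A B} {f : 𝒞 [ A , B ]} {g : 𝒞 [ B , A ]} →
                    𝒞 [ 𝒞 [ g ∘ f ] ≈ 𝒞.id ] → 𝒟 [ 𝒟 [ F₁ g ∘ F₁ f ] ≈ 𝒟.id ]
  F₁-resp-inverse g∘f≈id =
    𝒟.Equiv.trans (𝒟.Equiv.sym homomorphism) (𝒟.Equiv.trans (F-resp-≈ g∘f≈id) identity)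

  F₁-IsIso : ∀ {A B} {f : 𝒞 [ A , B ]} → IsIso 𝒞 f → IsIso 𝒟 (F₁ f)
  F₁-IsIso i = record
    { inv = F₁ inv ; isoˡ = F₁-resp-inverse isoˡ ; isoʳ = F₁-resp-inverse isoʳ }
    where open IsIso i

  NatIso-whiskerˡ : ∀ {o'' ℓ'' e''} {𝒜 : Category o'' ℓ'' e''} {P Q : PreFunctor 𝒜 𝒞} →
                    NatIso P Q → NatIso (pre ∘P P) (pre ∘P Q)
  NatIso-whiskerˡ α = record
    { η = λ X → F₁ (η X)
    ; η⁻¹ = λ X → F₁ (η⁻¹ X)
    ; commute = λ f → 𝒟.Equiv.trans (𝒟.Equiv.sym homomorphism)
                        (𝒟.Equiv.trans (F-resp-≈ (commute f)) homomorphism)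
    ; isoˡ = λ X → F₁-resp-inverse (isoˡ X)
    ; isoʳ = λ X → F₁-resp-inverse (isoʳ X)
    }
    where open NatIso α

module _ {o ℓ e o' ℓ' e'} {𝒜 : Category o ℓ e} {𝒞 : Category o' ℓ' e'} where
  open Category 𝒞
  open PreFunctor
  private
    module R {A B : Obj} = SetoidR (hom-setoid A B)
  open R

  NatIso-component : ∀ {P Q : PreFunctor 𝒜 𝒞} (α : NatIso P Q) X → IsIso 𝒞 (NatIso.η α X)
  NatIso-component α X = record { inv = η⁻¹ X ; isoˡ = isoˡ X ; isoʳ = isoʳ X }
    where open NatIso α

  NatIso-sym : ∀ {P Q : PreFunctor 𝒜 𝒞} → NatIso P Q → NatIso Q P
  NatIso-sym {P} {Q} α = record
    { η = η⁻¹ ; η⁻¹ = η ; commute = commute⁻¹ ; isoˡ = isoʳ ; isoʳ = isoˡ }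
    where
    open NatIso α
    commute⁻¹ : ∀ {X Y} (f : 𝒜 [ X , Y ]) → η⁻¹ Y ∘ F₁ Q f ≈ F₁ P f ∘ η⁻¹ X
    commute⁻¹ {X} {Y} f = begin
      η⁻¹ Y ∘ F₁ Q f                        ≈⟨ Equiv.sym identityʳ ⟩
      (η⁻¹ Y ∘ F₁ Q f) ∘ id                 ≈⟨ ∘-resp-≈ Equiv.refl (Equiv.sym (isoʳ X)) ⟩
      (η⁻¹ Y ∘ F₁ Q f) ∘ (η X ∘ η⁻¹ X)      ≈⟨ assoc ⟩
      η⁻¹ Y ∘ (F₁ Q f ∘ (η X ∘ η⁻¹ X))      ≈⟨ ∘-resp-≈ Equiv.refl (Equiv.sym assoc) ⟩
      η⁻¹ Y ∘ ((F₁ Q f ∘ η X) ∘ η⁻¹ X)      ≈⟨ ∘-resp-≈ Equiv.refl (∘-resp-≈ (Equiv.sym (commute f)) Equiv.refl) ⟩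
      η⁻¹ Y ∘ ((η Y ∘ F₁ P f) ∘ η⁻¹ X)      ≈⟨ ∘-resp-≈ Equiv.refl assoc ⟩
      η⁻¹ Y ∘ (η Y ∘ (F₁ P f ∘ η⁻¹ X))      ≈⟨ Equiv.sym assoc ⟩
      (η⁻¹ Y ∘ η Y) ∘ (F₁ P f ∘ η⁻¹ X)      ≈⟨ ∘-resp-≈ (isoˡ Y) Equiv.refl ⟩
      id ∘ (F₁ P f ∘ η⁻¹ X)                 ≈⟨ identityˡ ⟩
      F₁ P f ∘ η⁻¹ X                        ∎

  NatIso-trans : ∀ {P Q S : PreFunctor 𝒜 𝒞} → NatIso P Q → NatIso Q S → NatIso P S
  NatIso-trans {P} {Q} {S} α β = record
    { η = λ X → β.η X ∘ α.η X
    ; η⁻¹ = λ X → α.η⁻¹ X ∘ β.η⁻¹ X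
    ; commute = commute
    ; isoˡ = λ X → cancel (β.isoˡ X) (α.isoˡ X)
    ; isoʳ = λ X → cancel (α.isoʳ X) (β.isoʳ X)
    }
    where
    module α = NatIso α
    module β = NatIso β
    commute : ∀ {X Y} (f : 𝒜 [ X , Y ]) →
              (β.η Y ∘ α.η Y) ∘ F₁ P f ≈ F₁ S f ∘ (β.η X ∘ α.η X)
    commute {X} {Y} f = begin
      (β.η Y ∘ α.η Y) ∘ F₁ P f    ≈⟨ assoc ⟩
      β.η Y ∘ (α.η Y ∘ F₁ P f)    ≈⟨ ∘-resp-≈ Equiv.refl (α.commute f) ⟩
      β.η Y ∘ (F₁ Q f ∘ α.η X)    ≈⟨ Equiv.sym assoc ⟩
      (β.η Y ∘ F₁ Q f) ∘ α.η X    ≈⟨ ∘-resp-≈ (β.commute f) Equiv.refl ⟩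
      (F₁ S f ∘ β.η X) ∘ α.η X    ≈⟨ assoc ⟩
      F₁ S f ∘ (β.η X ∘ α.η X)    ∎
    cancel : ∀ {A B D} {f : A ⇒ B} {f⁻ : B ⇒ A} {g : B ⇒ D} {g⁻ : D ⇒ B} →
             g⁻ ∘ g ≈ id → f⁻ ∘ f ≈ id → (f⁻ ∘ g⁻) ∘ (g ∘ f) ≈ id
    cancel {f = f} {f⁻} {g} {g⁻} gg fg = begin
      (f⁻ ∘ g⁻) ∘ (g ∘ f)    ≈⟨ assoc ⟩
      f⁻ ∘ (g⁻ ∘ (g ∘ f))    ≈⟨ ∘-resp-≈ Equiv.refl (Equiv.sym assoc) ⟩
      f⁻ ∘ ((g⁻ ∘ g) ∘ f)    ≈⟨ ∘-resp-≈ Equiv.refl (∘-resp-≈ gg Equiv.refl) ⟩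
      f⁻ ∘ (id ∘ f)          ≈⟨ ∘-resp-≈ Equiv.refl identityˡ ⟩
      f⁻ ∘ f                 ≈⟨ fg ⟩
      id                     ∎

module _ {o ℓ e o' ℓ' e'} {E : Category o ℓ e} {B : Category o' ℓ' e'}
         (U : Functor E B) where
  private
    module E = Category E
    module B = Category B
  open Functor U

  opcartesian-IsIso : ∀ {P Q} {g : E [ P , Q ]} → IsOpcartesian U g →
                      IsIso B (F₁ g) → IsIso E g
  opcartesian-IsIso {g = g} oc Ug-iso = record
    { inv = g⁻¹ ; isoˡ = factor-comm E.id Ug.inv over-inv ; isoʳ = g∘g⁻¹≈id }
    where
    open IsOpcartesian oc
    module Ug = IsIso Ug-iso
    over-inv : B [ F₁ E.id ≈ B [ Ug.inv ∘ F₁ g ] ]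
    over-inv = B.Equiv.trans identity (B.Equiv.sym Ug.isoˡ)
    g⁻¹ : E [ _ , _ ]
    g⁻¹ = factor E.id Ug.inv over-inv
    over-id : B [ F₁ g ≈ B [ B.id ∘ F₁ g ] ]
    over-id = B.Equiv.sym B.identityˡ
    -- both g ∘ g⁻¹ and id factor g through itself over the identity
    g∘g⁻¹≈id : E [ E [ g ∘ g⁻¹ ] ≈ E.id ]
    g∘g⁻¹≈id = E.Equiv.trans
      (factor-unique g B.id over-id (E [ g ∘ g⁻¹ ])
        (B.Equiv.trans homomorphism
          (B.Equiv.trans (B.∘-resp-≈ B.Equiv.refl (factor-over E.id Ug.inv over-inv)) Ug.isoʳ))
        (E.Equiv.trans E.assoc
          (E.Equiv.trans (E.∘-resp-≈ E.Equiv.refl (factor-comm E.id Ug.inv over-inv)) E.identityʳ)))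
      (E.Equiv.sym (factor-unique g B.id over-id E.id identity E.identityˡ))

  lift-IsIso : (op : Opfibration U) (P : E.Obj) {Y : B.Obj} {f : B [ F₀ P , Y ]} →
               IsIso B f → IsIso E (Opfibration.lift op P f)
  lift-IsIso op P {f = f} f-iso = opcartesian-IsIso (lift-opcart P f)
    (IsIso-resp-≈ B (B.Equiv.sym (cast-transpose B refl (Σ-over P f) (lift-over P f)))
                    (IsIso-cast B refl (sym (Σ-over P f)) f-iso))
    where open Opfibration op

module _ {o ℓ e o' ℓ' e'} {B : Category o ℓ e} {E : Category o' ℓ' e'}
         {K : Functor B E} (full : Full K) (faithful : Faithful K)
         {C : Functor E B} (adj : Adjunction K C) where
  private
    module E = Category E
    module B = Category B
    module K = Functor K
    module C = Functor C
    module ER {P Q : E.Obj} = SetoidR (E.hom-setoid P Q)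
  open Adjunction adj

  unit⁻¹ : ∀ X → B [ C.F₀ (K.F₀ X) , X ]
  unit⁻¹ X = proj₁ (full (counit (K.F₀ X)))

  K-unit⁻¹ : ∀ X → E [ K.F₁ (unit⁻¹ X) ≈ counit (K.F₀ X) ]
  K-unit⁻¹ X = proj₂ (full (counit (K.F₀ X)))

  unit⁻¹-natIso : NatIso (C.pre ∘P K.pre) (idP B)
  unit⁻¹-natIso = record
    { η = unit⁻¹ ; η⁻¹ = unit ; commute = commute ; isoˡ = isoˡ ; isoʳ = isoʳ }
    where
    open ER
    commute : ∀ {X Y} (f : B [ X , Y ]) →
              B [ B [ unit⁻¹ Y ∘ C.F₁ (K.F₁ f) ] ≈ B [ f ∘ unit⁻¹ X ] ]
    commute {X} {Y} f = faithful _ _ (begin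
      K.F₁ (B [ unit⁻¹ Y ∘ C.F₁ (K.F₁ f) ])        ≈⟨ K.homomorphism ⟩
      E [ K.F₁ (unit⁻¹ Y) ∘ K.F₁ (C.F₁ (K.F₁ f)) ] ≈⟨ E.∘-resp-≈ (K-unit⁻¹ Y) E.Equiv.refl ⟩
      E [ counit (K.F₀ Y) ∘ K.F₁ (C.F₁ (K.F₁ f)) ] ≈⟨ counit-natural (K.F₁ f) ⟩
      E [ K.F₁ f ∘ counit (K.F₀ X) ]               ≈⟨ E.∘-resp-≈ E.Equiv.refl (E.Equiv.sym (K-unit⁻¹ X)) ⟩
      E [ K.F₁ f ∘ K.F₁ (unit⁻¹ X) ]               ≈⟨ E.Equiv.sym K.homomorphism ⟩
      K.F₁ (B [ f ∘ unit⁻¹ X ])                    ∎)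
    isoˡ : ∀ X → B [ B [ unit X ∘ unit⁻¹ X ] ≈ B.id ]
    isoˡ X = B.Equiv.trans (unit-natural (unit⁻¹ X))
               (B.Equiv.trans (B.∘-resp-≈ (C.F-resp-≈ (K-unit⁻¹ X)) B.Equiv.refl) (zag (K.F₀ X)))
    isoʳ : ∀ X → B [ B [ unit⁻¹ X ∘ unit X ] ≈ B.id ]
    isoʳ X = faithful _ _ (begin
      K.F₁ (B [ unit⁻¹ X ∘ unit X ])           ≈⟨ K.homomorphism ⟩
      E [ K.F₁ (unit⁻¹ X) ∘ K.F₁ (unit X) ]    ≈⟨ E.∘-resp-≈ (K-unit⁻¹ X) E.Equiv.refl ⟩
      E [ counit (K.F₀ X) ∘ K.F₁ (unit X) ]    ≈⟨ zig X ⟩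
      E.id                                     ≈⟨ E.Equiv.sym K.identity ⟩
      K.F₁ B.id                                ∎)

  counit-K-IsIso : ∀ X → IsIso E (counit (K.F₀ X))
  counit-K-IsIso X =
    IsIso-resp-≈ E (K-unit⁻¹ X) (F₁-IsIso K (NatIso-component unit⁻¹-natIso X))

module _ {o ℓ e o' ℓ' e'} {E : Category o ℓ e} {B : Category o' ℓ' e'}
         (U : Functor E B) (op : Opfibration U)
         (K : Functor B E) (UK : (Functor.pre U ∘P Functor.pre K) ≡F idP B)
         (C : Functor E B) (adj : Adjunction K C)
         (F : Functor B B) where
  open Hat U op K UK C adj F
  private
    module E = Category E
    module B = Category B
    module U = Functor U
    module K = Functor K
    module C = Functor C
    module F = Functor F
    module UK = _≡F_ UK
    open Opfibration op
    open PreFunctor using (F₀; F₁)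

  I₀-over : ∀ f → U.F₀ (I₀ f) ≡ ArrObj.cod f
  I₀-over (arr f) = Σ-over _ _

  I₁-over : ∀ {f g} (s : ArrHom B f g) →
            B [ B.cast (I₀-over f) (I₀-over g) (U.F₁ (I₁ s)) ≈ ArrHom.bot s ]
  I₁-over {arr f} {arr g} (sq a b c) =
    B.Equiv.trans (B.cast-resp _ _ (IsOpcartesian.factor-over (lift-opcart _ _) _ _ _))
                  (B.Equiv.reflexive (B.cast-sym' (I₀-over (arr f)) (I₀-over (arr g)) b))

  I-lift : ∀ f → E [ K.F₀ (ArrObj.dom f) , I₀ f ]
  I-lift (arr {X} f) = lift (K.F₀ X) (B.cast (sym (UK.eq₀ X)) refl f)

  I₁-lift : ∀ {f g} (s : ArrHom B f g) →
            E [ E [ I₁ s ∘ I-lift f ] ≈ E [ I-lift g ∘ K.F₁ (ArrHom.top s) ] ]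
  I₁-lift {arr f} {arr g} (sq a b c) = IsOpcartesian.factor-comm (lift-opcart _ _) _ _ _

  I-lift-IsIso : ∀ f → IsIso B (ArrObj.arrow f) → IsIso E (I-lift f)
  I-lift-IsIso (arr {X} f) f-iso =
    lift-IsIso U op (K.F₀ X) (IsIso-cast B (sym (UK.eq₀ X)) refl f-iso)

  U∘F̂≡F∘U : (U.pre ∘P F̂) ≡F (F.pre ∘P U.pre)
  U∘F̂≡F∘U = record
    { eq₀ = λ P → I₀-over (F₀ F→ (F₀ π P))
    ; eq₁ = λ h → I₁-over (F₁ F→ (F₁ π h))
    }

  module _ (full : Full K) (faithful : Faithful K) where

    πK-IsIso : ∀ X → IsIso B (ArrObj.arrow (F₀ π (K.F₀ X)))
    πK-IsIso X = IsIso-cast B (UK.eq₀ _) refl (F₁-IsIso U (counit-K-IsIso full faithful adj X))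

    F̂K-lift-natIso : NatIso (K.pre ∘P F.pre ∘P C.pre ∘P K.pre) (F̂ ∘P K.pre)
    F̂K-lift-natIso = record
      { η = λ X → I-lift (F₀ F→ (F₀ π (K.F₀ X)))
      ; η⁻¹ = λ X → IsIso.inv (lift-iso X)
      ; commute = λ f → E.Equiv.sym (I₁-lift (F₁ F→ (F₁ π (K.F₁ f))))
      ; isoˡ = λ X → IsIso.isoˡ (lift-iso X)
      ; isoʳ = λ X → IsIso.isoʳ (lift-iso X)
      }
      where
      lift-iso : ∀ X → IsIso E (I-lift (F₀ F→ (F₀ π (K.F₀ X))))
      lift-iso X = I-lift-IsIso _ (F₁-IsIso F (πK-IsIso X))

    F̂∘K≅K∘F : NatIso (F̂ ∘P K.pre) (K.pre ∘P F.pre)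
    F̂∘K≅K∘F = NatIso-trans (NatIso-sym F̂K-lift-natIso)
                (NatIso-whiskerˡ K (NatIso-whiskerˡ F (unit⁻¹-natIso full faithful adj)))

lemma3p9 : ∀ {o ℓ e o' ℓ' e'} {E : Category o ℓ e} {B : Category o' ℓ' e'}
    (U : Functor E B) (op : Opfibration U)
    (K : Functor B E) → Full K → Faithful K →
    (UK : (Functor.pre U ∘P Functor.pre K) ≡F idP B) →
    (C : Functor E B) (adj : Adjunction K C) →
    (F : Functor B B) →
    ((Functor.pre U ∘P Hat.F̂ U op K UK C adj F) ≡F (Functor.pre F ∘P Functor.pre U))
    × NatIso (Hat.F̂ U op K UK C adj F ∘P Functor.pre K) (Functor.pre K ∘P Functor.pre F)
lemma3p9 U op K full faithful UK C adj F =
  U∘F̂≡F∘U U op K UK C adj F , F̂∘K≅K∘F U op K UK C adj F full faithful
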